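{- Let $H$ be a finite connected simple graph with at least two vertices and $\Gamma(H)=2$. Then for every finite simple graph $G$, $\Gamma(G\times H)=\Gamma(G\times K_2)$.
   Context: The direct product $G\times H$ has vertex set $V(G)\times V(H)$, and $(a,x)(b,y)$ is an edge iff $ab\in E(G)$ and $xy\in E(H)$. A greedy $k$-colouring of a graph is a partition of its vertex set into $k$ nonempty stable sets $S_1,\dots,S_k$ such that for every $j<i$, every vertex of $S_i$ has a neighbour in $S_j$. The Grundy number $\Gamma$ is the largest such $k$. -}

module Defs where

open import Data.Nat using (ℕ; suc; _*_; _<_; _≤_)
open import Data.Fin using (Fin; toℕ; remQuot; _≟_)
open import Data.Bool using (Bool; _∧_; not; T)
open import Data.Product using (Σ; ∃; _×_; _,_; proj₁; proj₂)
open import Function using (Surjective)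
open import Relation.Binary.PropositionalEquality using (_≡_)
open import Relation.Nullary using (¬_)
open import Relation.Nullary.Decidable using (⌊_⌋)
open import Relation.Binary.Construct.Closure.ReflexiveTransitive using (Star)

record Graph : Set where
  constructor graph
  field
    n   : ℕ
    adj : Fin n → Fin n → Bool

open Graph public

V : Graph → Set
V G = Fin (n G)

Adj : (G : Graph) → V G → V G → Set
Adj G u v = T (adj G u v)

record IsSimple (G : Graph) : Set where
  field
    irrefl : ∀ u → ¬ Adj G u u
    sym    : ∀ u v → Adj G u v → Adj G v u

Connected : Graph → Set
Connected G = ∀ (u v : V G) → Star (Adj G) u v

K₂ : Graph
K₂ = graph 2 (λ u v → not ⌊ u ≟ v ⌋)

-- Direct (tensor/categorical) product; vertex (a , x) is encoded as
-- an element of Fin (n G * n H) via remQuot (a bijection Fin (n*m) ≅ Fin n × Fin m).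
_×ᵍ_ : Graph → Graph → Graph
G ×ᵍ H = graph (n G * n H) λ p q →
  let (a , x) = remQuot (n H) p
      (b , y) = remQuot (n H) q
  in adj G a b ∧ adj H x y

record GreedyColouring (G : Graph) (k : ℕ) : Set where
  field
    c        : V G → Fin k
    nonempty : Surjective _≡_ _≡_ c
    stable   : ∀ u v → Adj G u v → ¬ (c u ≡ c v)
    greedy   : ∀ v (j : Fin k) → toℕ j < toℕ (c v) → ∃ λ u → Adj G v u × c u ≡ j

GrundyNumber : Graph → ℕ → Set
GrundyNumber G k = GreedyColouring G k × (∀ k' → GreedyColouring G k' → k' ≤ k)

-- A connected graph with Γ(H) = 2 contains no walk a–b–c–d with a ≠ c and a ≁ d: first-fit along
-- the order {a, d} < c < b < rest would give b colour 2. Following walks, this forces H to be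
-- complete bipartite with the classes of its greedy 2-colouring as sides. Hence the colouring is a
-- full homomorphism H → K₂, so G × H → G × K₂ is a surjective full homomorphism: it only merges
-- vertices with equal neighbourhoods, which every greedy colouring colours alike, and greedy
-- colourings with k colours correspond on both sides.
module Submission where

open import Defs
open import Data.Nat using (ℕ; _≤_)
open import Function.Bundles using (_⇔_)

open import Data.Nat using (zero; suc; _+_; _*_; _<_; z≤n; s≤s; s≤s⁻¹; _<?_)
open import Data.Nat.Properties
  using (<-cmp; ≤-refl; ≤-trans; ≤-<-trans; ≤-antisym; <⇒≱; ≮⇒≥; ≤∧≢⇒<; n≮n; n≢0⇒n>0; n≤0⇒n≡0;
         m≤n⇒m<n∨m≡n; +-suc; +-identityʳ)
open import Data.Fin using (Fin; zero; suc; toℕ; fromℕ<; remQuot; combine; _≟_)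
open import Data.Fin.Properties using (toℕ<n; toℕ-injective; toℕ-fromℕ<; remQuot-combine; combine-remQuot)
open import Data.Bool.Properties using (T-∧)
open import Data.Product using (∃; _×_; _,_; proj₁; proj₂; uncurry; map₂)
open import Data.Product.Function.NonDependent.Propositional using (_×-⇔_)
open import Data.Sum using (_⊎_; inj₁; inj₂)
open import Data.List using (List; map; filter; allFin)
open import Data.List.Extrema.Nat using (max; xs≤max; argmax; f[xs]≤f[argmax])
open import Data.List.Relation.Unary.All as All using ()
open import Data.List.Relation.Unary.All.Properties using (all-filter)
open import Data.List.Membership.Propositional using (_∈_; _∉_)
open import Data.List.Membership.Propositional.Properties using (∈-map⁺; ∈-map⁻; ∈-filter⁺; ∈-allFin)
open import Data.List.Membership.DecPropositional Data.Nat._≟_ using (_∈?_)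
open import Data.List.Properties using (map-cong-local)
open import Function using (_∘_)
open import Function.Bundles using (mk⇔; Equivalence)
open import Function.Consequences.Propositional using (strictlySurjective⇒surjective; surjective⇒strictlySurjective)
import Function.Properties.Equivalence as ⇔
open import Relation.Binary.PropositionalEquality
open import Relation.Binary using (tri<; tri≈; tri>)
open import Relation.Binary.Construct.Closure.ReflexiveTransitive using (Star; ε; _◅_)
open import Relation.Nullary using (¬_; yes; no; contradiction)
open import Relation.Nullary.Decidable using (_×-dec_; T?; toWitnessFalse; fromWitnessFalse)
open import Relation.Unary using (Decidable)

open Equivalence using (to; from)

private
  variable
    k : ℕ

firstAbsentFrom : (fuel start : ℕ) → List ℕ → ℕ
firstAbsentFrom zero       i xs = i
firstAbsentFrom (suc fuel) i xs with i ∈? xs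
... | yes _ = firstAbsentFrom fuel (suc i) xs
... | no  _ = i

firstAbsentFrom-∉ : ∀ fuel i xs → max 0 xs < i + fuel → firstAbsentFrom fuel i xs ∉ xs
firstAbsentFrom-∉ zero i xs max<i i∈xs =
  <⇒≱ (subst (max 0 xs <_) (+-identityʳ i) max<i) (All.lookup (xs≤max 0 xs) i∈xs)
firstAbsentFrom-∉ (suc fuel) i xs max<i+1+fuel with i ∈? xs
... | yes _   = firstAbsentFrom-∉ fuel (suc i) xs (subst (max 0 xs <_) (+-suc i fuel) max<i+1+fuel)
... | no i∉xs = i∉xs

firstAbsentFrom-below : ∀ fuel i xs {j} → i ≤ j → j < firstAbsentFrom fuel i xs → j ∈ xs
firstAbsentFrom-below zero i xs i≤j j<i = contradiction i≤j (<⇒≱ j<i)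
firstAbsentFrom-below (suc fuel) i xs i≤j j<result with i ∈? xs
... | no _    = contradiction i≤j (<⇒≱ j<result)
... | yes i∈xs with m≤n⇒m<n∨m≡n i≤j
...   | inj₁ i<j  = firstAbsentFrom-below fuel (suc i) xs i<j j<result
...   | inj₂ refl = i∈xs

mex : List ℕ → ℕ
mex xs = firstAbsentFrom (suc (max 0 xs)) 0 xs

mex-∉ : ∀ xs → mex xs ∉ xs
mex-∉ xs = firstAbsentFrom-∉ (suc (max 0 xs)) 0 xs (s≤s ≤-refl)

<mex⇒∈ : ∀ xs {j} → j < mex xs → j ∈ xs
<mex⇒∈ xs = firstAbsentFrom-below (suc (max 0 xs)) 0 xs z≤n

mex-minimal : ∀ xs {m} → m ∉ xs → mex xs ≤ m
mex-minimal xs m∉xs = ≮⇒≥ (m∉xs ∘ <mex⇒∈ xs)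

record IsGreedyColouring (G : Graph) (C : V G → ℕ) : Set where
  field
    stable : ∀ u v → Adj G u v → C u ≢ C v
    greedy : ∀ v j → j < C v → ∃ λ u → Adj G v u × C u ≡ j

module _ {G : Graph} {C : V G → ℕ} (isGreedy : IsGreedyColouring G C) where
  open IsGreedyColouring isGreedy

  toGreedyColouring : ∀ w → (∀ v → C v ≤ C w) → GreedyColouring G (suc (C w))
  toGreedyColouring w C≤Cw = record
    { c        = colour
    ; nonempty = strictlySurjective⇒surjective hit
    ; stable   = λ u v u~v cu≡cv → stable u v u~v (colour≡⇒C≡ u v cu≡cv)
    ; greedy   = λ v j j<cv →
        let (u , v~u , Cu≡j) = greedy v (toℕ j) (subst (toℕ j <_) (toℕ-colour v) j<cv)
        in  u , v~u , C≡⇒colour≡ Cu≡j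
    }
    where
    colour : V G → Fin (suc (C w))
    colour v = fromℕ< (s≤s (C≤Cw v))

    toℕ-colour : ∀ v → toℕ (colour v) ≡ C v
    toℕ-colour v = toℕ-fromℕ< (s≤s (C≤Cw v))

    colour≡⇒C≡ : ∀ u v → colour u ≡ colour v → C u ≡ C v
    colour≡⇒C≡ u v e = trans (sym (toℕ-colour u)) (trans (cong toℕ e) (toℕ-colour v))

    C≡⇒colour≡ : ∀ {v j} → C v ≡ toℕ j → colour v ≡ j
    C≡⇒colour≡ e = toℕ-injective (trans (toℕ-colour _) e)

    hit : ∀ j → ∃ λ v → colour v ≡ j
    hit j with m≤n⇒m<n∨m≡n (s≤s⁻¹ (toℕ<n j))
    ... | inj₂ j≡Cw = w , C≡⇒colour≡ (sym j≡Cw)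
    ... | inj₁ j<Cw = let (u , _ , Cu≡j) = greedy w (toℕ j) j<Cw in u , C≡⇒colour≡ Cu≡j

  colour<grundy : GrundyNumber G k → ∀ v → C v < k
  colour<grundy (_ , maximal) v = ≤-<-trans (C≤Cw v) (maximal _ (toGreedyColouring w C≤Cw))
    where
    w : V G
    w = argmax C v (allFin _)

    C≤Cw : ∀ u → C u ≤ C w
    C≤Cw u = All.lookup (f[xs]≤f[argmax] v (allFin _)) (∈-allFin u)

module FirstFit {H : Graph} (simple : IsSimple H) (rank : V H → ℕ)
                (rank-adj : ∀ {u v} → Adj H u v → rank u ≢ rank v) where

  Earlier : V H → V H → Set
  Earlier v u = Adj H v u × rank u < rank v

  earlier? : ∀ v → Decidable (Earlier v)
  earlier? v u = T? (adj H v u) ×-dec (rank u <? rank v)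

  earlierNeighbours : V H → List (V H)
  earlierNeighbours v = filter (earlier? v) (allFin _)

  all-earlier : ∀ v → All.All (Earlier v) (earlierNeighbours v)
  all-earlier v = all-filter (earlier? v) (allFin _)

  ∈-earlierNeighbours⁺ : ∀ {v u} → Earlier v u → u ∈ earlierNeighbours v
  ∈-earlierNeighbours⁺ {v} {u} = ∈-filter⁺ (earlier? v) (∈-allFin u)

  -- Fuel stands in for well-founded recursion on rank: any fuel above rank v yields the same colour.
  colourWithFuel : ℕ → V H → ℕ
  colourWithFuel zero       v = 0
  colourWithFuel (suc fuel) v = mex (map (colourWithFuel fuel) (earlierNeighbours v))

  colourWithFuel-irrelevant : ∀ f g v → rank v < f → rank v < g → colourWithFuel f v ≡ colourWithFuel g v
  colourWithFuel-irrelevant (suc f) (suc g) v rv<1+f rv<1+g = cong mex (map-cong-local (All.map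
    (λ (_ , ru<rv) → colourWithFuel-irrelevant f g _ (≤-trans ru<rv (s≤s⁻¹ rv<1+f)) (≤-trans ru<rv (s≤s⁻¹ rv<1+g)))
    (all-earlier v)))

  firstFit : V H → ℕ
  firstFit v = colourWithFuel (suc (rank v)) v

  firstFit-mex : ∀ v → firstFit v ≡ mex (map firstFit (earlierNeighbours v))
  firstFit-mex v = cong mex (map-cong-local (All.map
    (λ (_ , ru<rv) → colourWithFuel-irrelevant (rank v) (suc (rank _)) _ ru<rv ≤-refl)
    (all-earlier v)))

  colourWithFuel-≤-rank : ∀ fuel v → colourWithFuel fuel v ≤ rank v
  colourWithFuel-≤-rank zero       v = z≤n
  colourWithFuel-≤-rank (suc fuel) v = mex-minimal _ rank∉colours
    where
    rank∉colours : rank v ∉ map (colourWithFuel fuel) (earlierNeighbours v)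
    rank∉colours rv∈ with ∈-map⁻ (colourWithFuel fuel) rv∈
    ... | u , u∈ , rv≡cu = <⇒≱ (proj₂ (All.lookup (all-earlier v) u∈))
                               (subst (_≤ rank u) (sym rv≡cu) (colourWithFuel-≤-rank fuel u))

  firstFit-≤-rank : ∀ v → firstFit v ≤ rank v
  firstFit-≤-rank v = colourWithFuel-≤-rank (suc (rank v)) v

  firstFit-≢-earlier : ∀ {v u} → Earlier v u → firstFit v ≢ firstFit u
  firstFit-≢-earlier {v} {u} v>u fv≡fu = mex-∉ (map firstFit (earlierNeighbours v))
    (subst (_∈ map firstFit (earlierNeighbours v)) (trans (sym fv≡fu) (firstFit-mex v))
      (∈-map⁺ firstFit (∈-earlierNeighbours⁺ v>u)))

  firstFit-isGreedy : IsGreedyColouring H firstFit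
  firstFit-isGreedy = record { stable = stable ; greedy = greedy }
    where
    open IsSimple simple renaming (sym to adj-sym)

    stable : ∀ u v → Adj H u v → firstFit u ≢ firstFit v
    stable u v u~v with <-cmp (rank u) (rank v)
    ... | tri< ru<rv _ _ = firstFit-≢-earlier (adj-sym u v u~v , ru<rv) ∘ sym
    ... | tri≈ _ ru≡rv _ = contradiction ru≡rv (rank-adj u~v)
    ... | tri> _ _ rv<ru = firstFit-≢-earlier (u~v , rv<ru)

    greedy : ∀ v j → j < firstFit v → ∃ λ u → Adj H v u × firstFit u ≡ j
    greedy v j j<fv with ∈-map⁻ firstFit (<mex⇒∈ _ (subst (j <_) (firstFit-mex v) j<fv))
    ... | u , u∈ , j≡fu = u , proj₁ (All.lookup (all-earlier v) u∈) , sym j≡fu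

-- a = d is allowed: then a, b, c form a triangle.
module _ {H : Graph} (simple : IsSimple H) {a b c d : V H}
         (b~a : Adj H b a) (b~c : Adj H b c) (c~d : Adj H c d) (a≢c : a ≢ c) (a≁d : ¬ Adj H a d)
         where
  open IsSimple simple renaming (sym to adj-sym)

  private
    IsEnd : V H → Set
    IsEnd v = v ≡ a ⊎ v ≡ d

    rank : V H → ℕ
    rank v with v ≟ a | v ≟ d | v ≟ c | v ≟ b
    ... | yes _ | _     | _     | _     = 0
    ... | no _  | yes _ | _     | _     = 0
    ... | no _  | no _  | yes _ | _     = 1
    ... | no _  | no _  | no _  | yes _ = 2
    ... | no _  | no _  | no _  | no _  = 3 + toℕ v

    data RankView : V H → ℕ → Set where
      end   : ∀ {v} → IsEnd v → RankView v 0
      at-c  : RankView c 1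
      at-b  : RankView b 2
      other : ∀ {v} → RankView v (3 + toℕ v)

    rankView : ∀ v → RankView v (rank v)
    rankView v with v ≟ a | v ≟ d | v ≟ c | v ≟ b
    ... | yes v≡a | _       | _        | _        = end (inj₁ v≡a)
    ... | no _    | yes v≡d | _        | _        = end (inj₂ v≡d)
    ... | no _    | no _    | yes refl | _        = at-c
    ... | no _    | no _    | no _     | yes refl = at-b
    ... | no _    | no _    | no _     | no _     = other

    other-index : ∀ {v i} → RankView v (3 + i) → toℕ v ≡ i
    other-index other = refl

    rank-tie : ∀ {u v r} → RankView u r → RankView v r → u ≡ v ⊎ (IsEnd u × IsEnd v)
    rank-tie (end u-end) (end v-end) = inj₂ (u-end , v-end)
    rank-tie at-c        at-c        = inj₁ refl
    rank-tie at-b        at-b        = inj₁ refl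
    rank-tie other       v-view      = inj₁ (toℕ-injective (sym (other-index v-view)))

    ends-nonadjacent : ∀ {u v} → IsEnd u → IsEnd v → ¬ Adj H u v
    ends-nonadjacent (inj₁ refl) (inj₁ refl) = irrefl a
    ends-nonadjacent (inj₁ refl) (inj₂ refl) = a≁d
    ends-nonadjacent (inj₂ refl) (inj₁ refl) = a≁d ∘ adj-sym d a
    ends-nonadjacent (inj₂ refl) (inj₂ refl) = irrefl d

    rank-adj : ∀ {u v} → Adj H u v → rank u ≢ rank v
    rank-adj {u} {v} u~v ru≡rv with rank-tie (rankView u) (subst (RankView v) (sym ru≡rv) (rankView v))
    ... | inj₁ refl           = irrefl u u~v
    ... | inj₂ (u-end , v-end) = ends-nonadjacent u-end v-end u~v

    rank-a : rank a ≡ 0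
    rank-a with a ≟ a
    ... | yes _   = refl
    ... | no a≢a = contradiction refl a≢a

    rank-d : rank d ≡ 0
    rank-d with d ≟ a | d ≟ d
    ... | yes _ | _      = refl
    ... | no _  | yes _  = refl
    ... | no _  | no d≢d = contradiction refl d≢d

    rank-c : rank c ≡ 1
    rank-c with c ≟ a | c ≟ d | c ≟ c
    ... | yes c≡a | _       | _      = contradiction (sym c≡a) a≢c
    ... | no _    | yes c≡d | _      = contradiction (subst (Adj H c) (sym c≡d) c~d) (irrefl c)
    ... | no _    | no _    | yes _  = refl
    ... | no _    | no _    | no c≢c = contradiction refl c≢c

    rank-b : rank b ≡ 2
    rank-b with b ≟ a | b ≟ d | b ≟ c | b ≟ b
    ... | yes b≡a | _       | _       | _      = contradiction (subst (Adj H b) (sym b≡a) b~a) (irrefl b)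
    ... | no _    | yes b≡d | _       | _      = contradiction (subst (Adj H a) b≡d (adj-sym b a b~a)) a≁d
    ... | no _    | no _    | yes b≡c | _      = contradiction (subst (Adj H b) (sym b≡c) b~c) (irrefl b)
    ... | no _    | no _    | no _    | yes _  = refl
    ... | no _    | no _    | no _    | no b≢b = contradiction refl b≢b

    open FirstFit simple rank rank-adj

    firstFit-rank0 : ∀ {v} → rank v ≡ 0 → firstFit v ≡ 0
    firstFit-rank0 {v} rv≡0 = n≤0⇒n≡0 (subst (firstFit v ≤_) rv≡0 (firstFit-≤-rank v))

    firstFit-c : firstFit c ≡ 1
    firstFit-c = ≤-antisym (subst (firstFit c ≤_) rank-c (firstFit-≤-rank c))
      (n≢0⇒n>0 λ fc≡0 → firstFit-≢-earlier c>d (trans fc≡0 (sym (firstFit-rank0 rank-d))))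
      where
      c>d : Earlier c d
      c>d = c~d , subst₂ _<_ (sym rank-d) (sym rank-c) (s≤s z≤n)

    2≤firstFit-b : 2 ≤ firstFit b
    2≤firstFit-b = ≤∧≢⇒< (n≢0⇒n>0 λ fb≡0 → firstFit-≢-earlier b>a (trans fb≡0 (sym (firstFit-rank0 rank-a))))
      λ 1≡fb → firstFit-≢-earlier b>c (trans (sym 1≡fb) (sym firstFit-c))
      where
      b>a : Earlier b a
      b>a = b~a , subst₂ _<_ (sym rank-a) (sym rank-b) (s≤s z≤n)
      b>c : Earlier b c
      b>c = b~c , subst₂ _<_ (sym rank-c) (sym rank-b) (s≤s (s≤s z≤n))

  3≤grundy : GrundyNumber H k → 3 ≤ k
  3≤grundy grundy = ≤-<-trans 2≤firstFit-b (colour<grundy firstFit-isGreedy grundy b)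

fin2-≢-≢⇒≡ : ∀ {x y z : Fin 2} → x ≢ y → x ≢ z → y ≡ z
fin2-≢-≢⇒≡ {zero}     {zero}                x≢y _   = contradiction refl x≢y
fin2-≢-≢⇒≡ {zero}     {suc zero} {zero}     _   x≢z = contradiction refl x≢z
fin2-≢-≢⇒≡ {zero}     {suc zero} {suc zero} _   _   = refl
fin2-≢-≢⇒≡ {suc zero} {zero}     {zero}     _   _   = refl
fin2-≢-≢⇒≡ {suc zero} {zero}     {suc zero} _   x≢z = contradiction refl x≢z
fin2-≢-≢⇒≡ {suc zero} {suc zero}            x≢y _   = contradiction refl x≢y

module _ {H : Graph} (simple : IsSimple H) (connected : Connected H) (grundy : GrundyNumber H 2) where
  open IsSimple simple renaming (sym to adj-sym)
  open GreedyColouring (proj₁ grundy) renaming (c to colour)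

  private
    no-induced-P₄ : ∀ {u w y x} → Adj H u w → Adj H w y → Adj H u x → Adj H x y
    no-induced-P₄ {w = w} {y} {x} u~w w~y u~x with x ≟ w | T? (adj H x y)
    ... | yes refl | _      = w~y
    ... | no _     | yes x~y = x~y
    ... | no x≢w   | no x≁y  = contradiction (3≤grundy simple u~x u~w w~y x≢w x≁y grundy) (n≮n 2)

    Joined : V H → V H → Set
    Joined u y = (colour u ≢ colour y → Adj H u y) × (colour u ≡ colour y → ∀ {x} → Adj H u x → Adj H x y)

    walk⇒joined : ∀ {u y} → Star (Adj H) u y → Joined u y
    walk⇒joined {u} ε = (λ cu≢cu → contradiction refl cu≢cu) , (λ _ {x} u~x → adj-sym u x u~x)
    walk⇒joined {u} {y} (_◅_ {j = v} u~v v⇝y) = different , same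
      where
      cu≢cv : colour u ≢ colour v
      cu≢cv = stable u v u~v

      different : colour u ≢ colour y → Adj H u y
      different cu≢cy = proj₂ (walk⇒joined v⇝y) (fin2-≢-≢⇒≡ cu≢cv cu≢cy) (adj-sym u v u~v)

      same : colour u ≡ colour y → ∀ {x} → Adj H u x → Adj H x y
      same cu≡cy = no-induced-P₄ u~v (proj₁ (walk⇒joined v⇝y) λ cv≡cy → cu≢cv (trans cu≡cy (sym cv≡cy)))

  grundy2⇒completeBipartite : ∀ x y → Adj H x y ⇔ colour x ≢ colour y
  grundy2⇒completeBipartite x y = mk⇔ (stable x y) (proj₁ (walk⇒joined (connected x y)))

greedy-twins : ∀ {G} (g : GreedyColouring G k) {p q} → (∀ r → Adj G p r ⇔ Adj G q r) →
               GreedyColouring.c g p ≡ GreedyColouring.c g q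
greedy-twins {G = G} g {p} {q} N[p]≡N[q] =
  toℕ-injective (≤-antisym (≮⇒≥ (no-smaller (to ∘ N[p]≡N[q]))) (≮⇒≥ (no-smaller (from ∘ N[p]≡N[q]))))
  where
  open GreedyColouring g
  no-smaller : ∀ {u v} → (∀ r → Adj G v r → Adj G u r) → ¬ toℕ (c u) < toℕ (c v)
  no-smaller {u} {v} N[v]⊆N[u] cu<cv =
    let (r , v~r , cr≡cu) = greedy v (c u) cu<cv in stable u r (N[v]⊆N[u] r v~r) (sym cr≡cu)

record FullSurjection (A B : Graph) : Set where
  field
    ⟦_⟧       : V A → V B
    section   : V B → V A
    ⟦section⟧ : ∀ y → ⟦ section y ⟧ ≡ y
    Adj-⟦⟧    : ∀ p q → Adj A p q ⇔ Adj B ⟦ p ⟧ ⟦ q ⟧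

module _ {A B : Graph} (π : FullSurjection A B) where
  open FullSurjection π

  private
    Adj-section : ∀ {x y} → Adj B x y → Adj A (section x) (section y)
    Adj-section {x} {y} x~y = from (Adj-⟦⟧ _ _) (subst₂ (Adj B) (sym (⟦section⟧ x)) (sym (⟦section⟧ y)) x~y)

    section-twin : ∀ p r → Adj A (section ⟦ p ⟧) r ⇔ Adj A p r
    section-twin p r = ⇔.trans (Adj-⟦⟧ _ r)
      (subst (λ x → Adj B x ⟦ r ⟧ ⇔ Adj A p r) (sym (⟦section⟧ ⟦ p ⟧)) (⇔.sym (Adj-⟦⟧ p r)))

  pullback : GreedyColouring B k → GreedyColouring A k
  pullback g = record
    { c        = c ∘ ⟦_⟧
    ; nonempty = strictlySurjective⇒surjective λ j →
        let (y , cy≡j) = surjective⇒strictlySurjective nonempty j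
        in  section y , trans (cong c (⟦section⟧ y)) cy≡j
    ; stable   = λ p q p~q → stable ⟦ p ⟧ ⟦ q ⟧ (to (Adj-⟦⟧ p q) p~q)
    ; greedy   = λ p j j<cp →
        let (y , ⟦p⟧~y , cy≡j) = greedy ⟦ p ⟧ j j<cp
        in  section y , from (Adj-⟦⟧ p (section y)) (subst (Adj B ⟦ p ⟧) (sym (⟦section⟧ y)) ⟦p⟧~y)
                      , trans (cong c (⟦section⟧ y)) cy≡j
    }
    where open GreedyColouring g

  pushforward : GreedyColouring A k → GreedyColouring B k
  pushforward g = record
    { c        = c ∘ section
    ; nonempty = strictlySurjective⇒surjective λ j →
        let (p , cp≡j) = surjective⇒strictlySurjective nonempty j
        in  ⟦ p ⟧ , trans (c-section p) cp≡j
    ; stable   = λ x y x~y → stable (section x) (section y) (Adj-section x~y)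
    ; greedy   = λ x j j<cx →
        let (r , sx~r , cr≡j) = greedy (section x) j j<cx
        in  ⟦ r ⟧ , subst (λ z → Adj B z ⟦ r ⟧) (⟦section⟧ x) (to (Adj-⟦⟧ (section x) r) sx~r)
                  , trans (c-section r) cr≡j
    }
    where
    open GreedyColouring g
    c-section : ∀ p → c (section ⟦ p ⟧) ≡ c p
    c-section p = greedy-twins g (section-twin p)

  grundyNumber-⇔ : GrundyNumber A k ⇔ GrundyNumber B k
  grundyNumber-⇔ = mk⇔
    (λ (g , maximal) → pushforward g , λ k′ g′ → maximal k′ (pullback g′))
    (λ (g , maximal) → pullback g , λ k′ g′ → maximal k′ (pushforward g′))

Adj-K₂ : ∀ i j → Adj K₂ i j ⇔ i ≢ j
Adj-K₂ i j = mk⇔ toWitnessFalse fromWitnessFalse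

Adj-×ᵍ : ∀ G H a x b y → Adj (G ×ᵍ H) (combine a x) (combine b y) ⇔ (Adj G a b × Adj H x y)
Adj-×ᵍ G H a x b y =
  subst₂ (λ r s → Adj (G ×ᵍ H) (combine a x) (combine b y) ⇔
                  (Adj G (proj₁ r) (proj₁ s) × Adj H (proj₂ r) (proj₂ s)))
         (remQuot-combine {n G} {n H} a x) (remQuot-combine {n G} {n H} b y) T-∧

×ᵍ-fullSurjection : ∀ G {H H′} → FullSurjection H H′ → FullSurjection (G ×ᵍ H) (G ×ᵍ H′)
×ᵍ-fullSurjection G {H} {H′} π = record
  { ⟦_⟧       = mapʳ ⟦_⟧
  ; section   = mapʳ section
  ; ⟦section⟧ = mapʳ-section
  ; Adj-⟦⟧    = Adj-mapʳ
  }
  where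
  open FullSurjection π
  open ≡-Reasoning

  mapʳ : ∀ {m m′} → (Fin m → Fin m′) → Fin (n G * m) → Fin (n G * m′)
  mapʳ {m} f p = uncurry combine (map₂ f (remQuot {n G} m p))

  mapʳ-section : ∀ p → mapʳ ⟦_⟧ (mapʳ section p) ≡ p
  mapʳ-section p = begin
    mapʳ ⟦_⟧ (mapʳ section p)   ≡⟨ cong (uncurry combine ∘ map₂ ⟦_⟧) (remQuot-combine {n G} {n H} a (section y)) ⟩
    combine a ⟦ section y ⟧     ≡⟨ cong (combine a) (⟦section⟧ y) ⟩
    combine a y                 ≡⟨ combine-remQuot {n G} (n H′) p ⟩
    p                           ∎
    where
    a = proj₁ (remQuot {n G} (n H′) p)
    y = proj₂ (remQuot {n G} (n H′) p)

  Adj-mapʳ : ∀ p q → Adj (G ×ᵍ H) p q ⇔ Adj (G ×ᵍ H′) (mapʳ ⟦_⟧ p) (mapʳ ⟦_⟧ q)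
  Adj-mapʳ p q = ⇔.trans T-∧ (⇔.trans (⇔.refl ×-⇔ Adj-⟦⟧ x y) (⇔.sym (Adj-×ᵍ G H′ a ⟦ x ⟧ b ⟦ y ⟧)))
    where
    a = proj₁ (remQuot {n G} (n H) p)
    x = proj₂ (remQuot {n G} (n H) p)
    b = proj₁ (remQuot {n G} (n H) q)
    y = proj₂ (remQuot {n G} (n H) q)

grundy2⇒fullSurjection-K₂ : ∀ {H} → IsSimple H → Connected H → GrundyNumber H 2 → FullSurjection H K₂
grundy2⇒fullSurjection-K₂ simple connected grundy = record
  { ⟦_⟧       = c
  ; section   = λ j → proj₁ (surjective⇒strictlySurjective nonempty j)
  ; ⟦section⟧ = λ j → proj₂ (surjective⇒strictlySurjective nonempty j)
  ; Adj-⟦⟧    = λ x y →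
      ⇔.trans (grundy2⇒completeBipartite simple connected grundy x y) (⇔.sym (Adj-K₂ (c x) (c y)))
  }
  where open GreedyColouring (proj₁ grundy)

corollary41 : (H : Graph) → IsSimple H → Connected H → 2 ≤ n H → GrundyNumber H 2 →
    (G : Graph) → IsSimple G →
    ∀ (k : ℕ) → GrundyNumber (G ×ᵍ H) k ⇔ GrundyNumber (G ×ᵍ K₂) k
corollary41 H simple connected _ grundy G _ k =
  grundyNumber-⇔ (×ᵍ-fullSurjection G (grundy2⇒fullSurjection-K₂ simple connected grundy))
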